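{- Let $\mathbb{F}_q$ be a finite field with $q$ elements, and let $A,B\subseteq \mathbb{F}_q$ satisfy $|A|\,|B|>q$, $-A\subseteq A+A$ and $-B\subseteq B+B$. Let $\xi\in\mathbb{F}_q^*$ be such that (i) the equation $a_1+\xi b_1=a_2+\xi b_2$ has strictly fewer than $\frac{2}{q}|A|^2|B|^2$ solutions $(a_1,b_1,a_2,b_2)\in A\times B\times A\times B$, and (ii) $|A+\xi B|>\frac q2$ and $|A-\xi B|>\frac q2$. For $\varepsilon,\delta\in\{1,-1\}$ write $S_{\varepsilon,\delta}=\{\varepsilon a+\delta\xi b: a\in A,\ b\in B\}$ (so $S_{1,1}=A+\xi B$, $S_{1,-1}=A-\xi B$, $S_{ -1,-1}=-(A+\xi B)$, $S_{ -1,1}=-(A-\xi B)$). Suppose there exist two distinct sign pairs $(\varepsilon_1,\delta_1)\neq(\varepsilon_2,\delta_2)$ and elements $a_1,a_2\in A$, $b_1,b_2\in B$ with $$\varepsilon_1 a_1+\delta_1\xi b_1=\varepsilon_2 a_2+\delta_2\xi b_2\quad\text{and}\quad \varepsilon_1a_1\neq \varepsilon_2 a_2$$ (i.e. some element $x$ of $S_{\varepsilon_1,\delta_1}\cap S_{\varepsilon_2,\delta_2}$ has a representation determining $\xi=\frac{\varepsilon_2a_2-\varepsilon_1a_1}{\delta_1b_1-\delta_2b_2}$ with nonzero denominator; such $x$ is called non-trivial). Then $10AB=\mathbb{F}_q$.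
   Context: For $A,B\subseteq\mathbb{F}_q$ and $\xi\in\mathbb{F}_q^*$: $-A=\{ -a:a\in A\}$, $A+A=\{a+a': a,a'\in A\}$, $A\pm\xi B=\{a\pm\xi b: a\in A, b\in B\}$, $AB=\{ab: a\in A,\ b\in B\}$, and $10AB$ denotes the set of all sums $a_1b_1+\dots+a_{10}b_{10}$ with $a_i\in A$, $b_i\in B$. An element $x$ in the intersection of two distinct sets among $A+\xi B$, $A-\xi B$, $-(A+\xi B)$, $-(A-\xi B)$ is called trivial if none of its representations as in the claim determines $\xi$ unambiguously (i.e. all such representations have $\varepsilon_1a_1=\varepsilon_2a_2$), and non-trivial otherwise. -}

module Defs where

open import Level using (0ℓ)
open import Algebra.Bundles using (CommutativeRing)
open import Data.Nat using (ℕ; zero; suc)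
open import Data.Fin using (Fin)
import Data.Fin as Fin
open import Data.Fin.Subset using (Subset)
open import Data.Fin.Properties using (any?)
open import Data.Vec using (lookup; tabulate)
open import Data.Bool using (Bool; true; false; _∧_; if_then_else_)
open import Data.List using (List; allFin; map)
open import Data.Nat.ListAction using (sum)
open import Data.Bool.Properties using (T?)
open import Relation.Nullary using (_×-dec_)
open import Data.Product using (Σ; ∃; _×_; _,_)
open import Data.Sign using (Sign)
open import Relation.Nullary using (¬_; Dec; does)
open import Relation.Binary.PropositionalEquality using (_≡_)

record FiniteField : Set₁ where
  field
    commRing : CommutativeRing 0ℓ 0ℓ
  open CommutativeRing commRing public
  field
    _≟_      : (x y : Carrier) → Dec (x ≈ y)
    1≉0      : ¬ (1# ≈ 0#)
    inverse  : (x : Carrier) → ¬ (x ≈ 0#) → Σ Carrier (λ y → (x * y) ≈ 1#)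
    q        : ℕ
    elem     : Fin q → Carrier
    elem-inj : (i j : Fin q) → elem i ≈ elem j → i ≡ j
    elem-sur : (x : Carrier) → Σ (Fin q) (λ i → elem i ≈ x)

module FF (F : FiniteField) where
  open FiniteField F

  -- Subsets of F_q are subsets of the index set Fin q (index i ↦ elem i).
  -- Image of A × B under a binary operation f, as a subset of F_q.
  image2 : (Carrier → Carrier → Carrier) → Subset q → Subset q → Subset q
  image2 f A B = tabulate λ k →
    does (any? λ i → any? λ j →
      T? (lookup A i ∧ lookup B j) ×-dec (f (elem i) (elem j) ≟ elem k))

  countF : (Fin q → ℕ) → ℕ
  countF g = sum (map g (allFin q))

  solutions : Carrier → Subset q → Subset q → ℕ
  solutions ξ A B =
    countF λ a₁ → countF λ b₁ → countF λ a₂ → countF λ b₂ →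
      if lookup A a₁ ∧ lookup B b₁ ∧ lookup A a₂ ∧ lookup B b₂
           ∧ does ((elem a₁ + ξ * elem b₁) ≟ (elem a₂ + ξ * elem b₂))
      then 1 else 0

  sgn : Sign → Carrier → Carrier
  sgn Sign.+ x = x
  sgn Sign.- x = - x

  Σ[_] : (n : ℕ) → (Fin n → Carrier) → Carrier
  Σ[ zero ] f = 0#
  Σ[ suc n ] f = f Fin.zero + Σ[ n ] (λ i → f (Fin.suc i))

module Submission where

-- Let the non-trivial collision be
--   ε₁a₁ + δ₁ξb₁ = ε₂a₂ + δ₂ξb₂  with  ε₁a₁ ≠ ε₂a₂,
-- and put t = δ₁b₁ − δ₂b₂ and s = ε₂a₂ − ε₁a₁.  Then ξt = s and t ≠ 0.
-- Since |A+ξB| + |A−ξB| > q, a pigeonhole argument shows that for any signs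
-- ε, η every z ∈ F_q can be written z = ε(a + ξb) + η(a' − ξb').  Taking
-- z = x/t and using ξt = s,
--   x = ε(ta + sb) + η(ta' − sb'),
-- and expanding t and s writes x as eight signed products ±a·b with a ∈ A,
-- b ∈ B.  A product +a·b is one term of 10AB; because −A ⊆ A + A, a product
-- −a·b is two terms.  For the right choice of (ε, η) exactly two of the
-- eight signs are negative, giving exactly ten terms.

open import Defs
open import Data.Nat using (ℕ) renaming (_*_ to _*ℕ_; _<_ to _<ℕ_)
open import Data.Fin using (Fin)
open import Data.Fin.Subset using (Subset; _∈_; ∣_∣)
open import Data.Sign using (Sign)
open import Data.Product using (Σ; _×_; _,_)
open import Relation.Nullary using (¬_)
open import Relation.Binary.PropositionalEquality using (_≢_)

open import Algebra.Bundles using (CommutativeRing)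
open import Algebra.Solver.Ring.AlmostCommutativeRing
  using (fromCommutativeRing; _-Raw-AlmostCommutative⟶_)
open import Data.Bool using (true; false; T; _∧_)
open import Data.Bool.Properties using (T?; T-≡; T-∧)
import Data.Fin as Fin
open import Data.Fin.Properties using (any?; injective⇒≤; join-splitAt; suc-injective)
open import Data.Integer as ℤ using (ℤ; +_; -[1+_]; _⊖_)
import Data.Integer.Properties as ℤP
open import Data.Maybe using (map)
open import Data.Nat using (suc) renaming (_+_ to _+ℕ_)
import Data.Nat.Properties as ℕP
open import Data.Product using (proj₁; proj₂)
open import Data.Sign using (opposite) renaming (_*_ to _*ˢ_)
open import Data.Sign.Properties using (s*s≡+)
open import Data.Sum using (inj₁; inj₂; [_,_]′)
open import Data.Vec using (_∷_; lookup; here; there)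
open import Data.Vec.Properties using (lookup∘tabulate; []=⇒lookup; lookup⇒[]=)
open import Data.Vec.Functional using (_++_)
open import Data.Vec.Functional.Properties using (lookup-++ˡ; lookup-++ʳ)
open import Data.Vec.Functional.Relation.Unary.All using (All)
open import Data.Vec.Functional.Relation.Unary.All.Properties using (++⁺)
open import Data.Empty using (⊥-elim)
open import Function using (_∘_; Injective)
open import Function.Bundles using (Equivalence)
open import Relation.Binary.Consequences using (dec⇒weaklyDec)
open import Relation.Binary.PropositionalEquality
  using (_≡_; refl; cong; cong₂; subst)
  renaming (sym to ≡-sym; trans to ≡-trans)
open import Relation.Nullary using (Dec; yes; no; does; proof; contradiction; _×-dec_)
open import Relation.Nullary.Reflects using (Reflects; invert)

module Signs {c ℓ} (R : CommutativeRing c ℓ) where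
  open CommutativeRing R renaming (refl to ≈-refl)
  open import Algebra.Properties.Ring ring using (-1*x≈-x; -‿involutive)
  open import Relation.Binary.Reasoning.Setoid setoid

  σ : Sign → Carrier
  σ Sign.+ = 1#
  σ Sign.- = - 1#

  σ-* : ∀ s u → σ (s *ˢ u) ≈ σ s * σ u
  σ-* Sign.+ Sign.+ = sym (*-identityˡ 1#)
  σ-* Sign.+ Sign.- = sym (*-identityˡ (- 1#))
  σ-* Sign.- Sign.+ = sym (*-identityʳ (- 1#))
  σ-* Sign.- Sign.- = begin
    1#            ≈⟨ -‿involutive 1# ⟨
    - (- 1#)      ≈⟨ -1*x≈-x (- 1#) ⟨
    - 1# * - 1#   ∎

  σ-opposite : ∀ s → σ (opposite s) ≈ - σ s
  σ-opposite Sign.+ = ≈-refl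
  σ-opposite Sign.- = sym (-‿involutive 1#)

  σ-*-opposite : ∀ s u → σ (s *ˢ opposite u) ≈ σ s * - σ u
  σ-*-opposite s u = trans (σ-* s (opposite u)) (*-congˡ (σ-opposite u))

  σ-cancel : ∀ s v → σ s * (σ s * v) ≈ v
  σ-cancel s v = begin
    σ s * (σ s * v)   ≈⟨ *-assoc (σ s) (σ s) v ⟨
    σ s * σ s * v     ≈⟨ *-congʳ (σ-* s s) ⟨
    σ (s *ˢ s) * v    ≡⟨ cong (λ r → σ r * v) (s*s≡+ s) ⟩
    1# * v            ≈⟨ *-identityˡ v ⟩
    v                 ∎

-- The ring solver over an arbitrary commutative ring, with integer
-- coefficients interpreted through the canonical map ℤ → R.

module IntegerCoefficients {c ℓ} (R : CommutativeRing c ℓ) where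
  open CommutativeRing R renaming (refl to ≈-refl)
  open Signs R
  open import Algebra.Properties.Ring ring
    using (-0#≈0#; -1*x≈-x; -‿involutive; -‿+-comm)
  open import Algebra.Properties.Semiring.Mult semiring
    using (×-homo-+; ×1-homo-*) renaming (_×_ to _×ᵣ_)
  open import Algebra.Properties.CommutativeSemigroup *-commutativeSemigroup
    using (interchange)
  open import Relation.Binary.Reasoning.Setoid setoid

  ⟦_⟧ : ℤ → Carrier
  ⟦ + n ⟧      = n ×ᵣ 1#
  ⟦ -[1+ n ] ⟧ = - (suc n ×ᵣ 1#)

  shift-difference : ∀ x y → x - y ≈ (1# + x) - (1# + y)
  shift-difference x y = begin
    x - y                        ≈⟨ +-identityˡ (x - y) ⟨
    0# + (x - y)                 ≈⟨ +-congʳ (-‿inverseʳ 1#) ⟨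
    (1# - 1#) + (x - y)          ≈⟨ +-assoc 1# (- 1#) (x - y) ⟩
    1# + (- 1# + (x - y))        ≈⟨ +-congˡ (+-assoc (- 1#) x (- y)) ⟨
    1# + ((- 1# + x) - y)        ≈⟨ +-congˡ (+-congʳ (+-comm (- 1#) x)) ⟩
    1# + ((x - 1#) - y)          ≈⟨ +-congˡ (+-assoc x (- 1#) (- y)) ⟩
    1# + (x + (- 1# - y))        ≈⟨ +-assoc 1# x (- 1# - y) ⟨
    (1# + x) + (- 1# - y)        ≈⟨ +-congˡ (-‿+-comm 1# y) ⟩
    (1# + x) - (1# + y)          ∎

  ⊖-homo : ∀ m n → ⟦ m ⊖ n ⟧ ≈ m ×ᵣ 1# - n ×ᵣ 1#
  ⊖-homo m 0 = begin
    m ×ᵣ 1#        ≈⟨ +-identityʳ _ ⟨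
    m ×ᵣ 1# + 0#   ≈⟨ +-congˡ -0#≈0# ⟨
    m ×ᵣ 1# - 0#   ∎
  ⊖-homo 0 (suc n) = sym (+-identityˡ _)
  ⊖-homo (suc m) (suc n) = begin
    ⟦ suc m ⊖ suc n ⟧                ≡⟨ cong ⟦_⟧ (ℤP.[1+m]⊖[1+n]≡m⊖n m n) ⟩
    ⟦ m ⊖ n ⟧                        ≈⟨ ⊖-homo m n ⟩
    m ×ᵣ 1# - n ×ᵣ 1#                ≈⟨ shift-difference _ _ ⟩
    (1# + m ×ᵣ 1#) - (1# + n ×ᵣ 1#)  ∎

  +-homo : ∀ i j → ⟦ i ℤ.+ j ⟧ ≈ ⟦ i ⟧ + ⟦ j ⟧
  +-homo (+ m)    (+ n)    = ×-homo-+ 1# m n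
  +-homo (+ m)    -[1+ n ] = ⊖-homo m (suc n)
  +-homo -[1+ m ] (+ n)    = trans (⊖-homo n (suc m)) (+-comm _ _)
  +-homo -[1+ m ] -[1+ n ] = begin
    - ((2 +ℕ (m +ℕ n)) ×ᵣ 1#)       ≡⟨ cong (λ k → - (suc k ×ᵣ 1#)) (ℕP.+-suc m n) ⟨
    - ((suc m +ℕ suc n) ×ᵣ 1#)      ≈⟨ -‿cong (×-homo-+ 1# (suc m) (suc n)) ⟩
    - (suc m ×ᵣ 1# + suc n ×ᵣ 1#)   ≈⟨ -‿+-comm _ _ ⟨
    ⟦ -[1+ m ] ⟧ + ⟦ -[1+ n ] ⟧     ∎

  sign-abs : ∀ i → ⟦ i ⟧ ≈ σ (ℤ.sign i) * (ℤ.∣ i ∣ ×ᵣ 1#)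
  sign-abs (+ n)    = sym (*-identityˡ _)
  sign-abs -[1+ n ] = sym (-1*x≈-x _)

  ◃-homo : ∀ s n → ⟦ s ℤ.◃ n ⟧ ≈ σ s * (n ×ᵣ 1#)
  ◃-homo s      0       = sym (zeroʳ (σ s))
  ◃-homo Sign.+ (suc n) = sym (*-identityˡ _)
  ◃-homo Sign.- (suc n) = sym (-1*x≈-x _)

  *-homo : ∀ i j → ⟦ i ℤ.* j ⟧ ≈ ⟦ i ⟧ * ⟦ j ⟧
  *-homo i j = begin
    ⟦ i ℤ.* j ⟧
      ≈⟨ ◃-homo (ℤ.sign i *ˢ ℤ.sign j) (ℤ.∣ i ∣ *ℕ ℤ.∣ j ∣) ⟩
    σ (ℤ.sign i *ˢ ℤ.sign j) * ((ℤ.∣ i ∣ *ℕ ℤ.∣ j ∣) ×ᵣ 1#)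
      ≈⟨ *-cong (σ-* (ℤ.sign i) (ℤ.sign j)) (×1-homo-* ℤ.∣ i ∣ ℤ.∣ j ∣) ⟩
    (σ (ℤ.sign i) * σ (ℤ.sign j)) * ((ℤ.∣ i ∣ ×ᵣ 1#) * (ℤ.∣ j ∣ ×ᵣ 1#))
      ≈⟨ interchange _ _ _ _ ⟩
    (σ (ℤ.sign i) * (ℤ.∣ i ∣ ×ᵣ 1#)) * (σ (ℤ.sign j) * (ℤ.∣ j ∣ ×ᵣ 1#))
      ≈⟨ *-cong (sign-abs i) (sign-abs j) ⟨
    ⟦ i ⟧ * ⟦ j ⟧
      ∎

  neg-homo : ∀ i → ⟦ ℤ.- i ⟧ ≈ - ⟦ i ⟧
  neg-homo (+ 0)       = sym -0#≈0#
  neg-homo (+ suc n)   = ≈-refl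
  neg-homo -[1+ n ]    = sym (-‿involutive _)

  homomorphism : ℤ.+-*-rawRing -Raw-AlmostCommutative⟶ fromCommutativeRing R
  homomorphism = record
    { ⟦_⟧ = ⟦_⟧ ; +-homo = +-homo ; *-homo = *-homo ; -‿homo = neg-homo
    ; 0-homo = ≈-refl ; 1-homo = +-identityʳ 1# }

  open import Algebra.Solver.Ring ℤ.+-*-rawRing (fromCommutativeRing R) homomorphism
    (λ i j → map (λ i≡j → reflexive (cong ⟦_⟧ i≡j)) (dec⇒weaklyDec ℤ._≟_ i j))
    public using (solve; _:=_; _:+_; _:*_; :-_; _:-_)

module Identities {c ℓ} (R : CommutativeRing c ℓ) where
  open CommutativeRing R renaming (refl to ≈-refl)
  open Signs R
  open IntegerCoefficients R
  open import Relation.Binary.Reasoning.Setoid setoid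

  slope : ∀ ξ u₁ u₂ c₁ c₂ b₁ b₂ → u₁ + c₁ * (ξ * b₁) ≈ u₂ + c₂ * (ξ * b₂) →
          ξ * (c₁ * b₁ - c₂ * b₂) ≈ u₂ - u₁
  slope ξ u₁ u₂ c₁ c₂ b₁ b₂ collision = begin
    ξ * (c₁ * b₁ - c₂ * b₂)
      ≈⟨ solve 7 (λ ξ u₁ u₂ c₁ c₂ b₁ b₂ →
           ξ :* (c₁ :* b₁ :- c₂ :* b₂) :=
           ((u₁ :+ c₁ :* (ξ :* b₁)) :- (u₂ :+ c₂ :* (ξ :* b₂))) :+ (u₂ :- u₁))
           ≈-refl ξ u₁ u₂ c₁ c₂ b₁ b₂ ⟩
    ((u₁ + c₁ * (ξ * b₁)) - (u₂ + c₂ * (ξ * b₂))) + (u₂ - u₁)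
      ≈⟨ +-congʳ (trans (+-congʳ collision) (-‿inverseʳ _)) ⟩
    0# + (u₂ - u₁)
      ≈⟨ +-identityˡ _ ⟩
    u₂ - u₁
      ∎

  expand : ∀ ξ t s ε η a b a' b' → ξ * t ≈ s →
           t * (σ ε * (a + ξ * b) + σ η * (a' - ξ * b'))
             ≈ (σ ε * (t * a) + σ ε * (s * b)) + (σ η * (t * a') + σ (opposite η) * (s * b'))
  expand ξ t s ε η a b a' b' ξt≈s = begin
    t * (σ ε * (a + ξ * b) + σ η * (a' - ξ * b'))
      ≈⟨ solve 8 (λ ξ t e h a b a' b' →
           t :* (e :* (a :+ ξ :* b) :+ h :* (a' :- ξ :* b')) :=
           (e :* (t :* a) :+ e :* ((ξ :* t) :* b)) :+ (h :* (t :* a') :+ (:- h) :* ((ξ :* t) :* b')))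
           ≈-refl ξ t (σ ε) (σ η) a b a' b' ⟩
    (σ ε * (t * a) + σ ε * ((ξ * t) * b)) + (σ η * (t * a') + (- σ η) * ((ξ * t) * b'))
      ≈⟨ +-cong (+-congˡ (*-congˡ (*-congʳ ξt≈s)))
                (+-congˡ (*-cong (sym (σ-opposite η)) (*-congʳ ξt≈s))) ⟩
    (σ ε * (t * a) + σ ε * (s * b)) + (σ η * (t * a') + σ (opposite η) * (s * b'))
      ∎

  four-products : ∀ u v δ₁ δ₂ ε₁ ε₂ a b a₁ a₂ b₁ b₂ →
    σ u * ((σ δ₁ * b₁ - σ δ₂ * b₂) * a) + σ v * ((σ ε₂ * a₂ - σ ε₁ * a₁) * b)
      ≈ σ (u *ˢ δ₁) * (a * b₁) + (σ (u *ˢ opposite δ₂) * (a * b₂)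
        + (σ (v *ˢ ε₂) * (a₂ * b) + σ (v *ˢ opposite ε₁) * (a₁ * b)))
  four-products u v δ₁ δ₂ ε₁ ε₂ a b a₁ a₂ b₁ b₂ = begin
    σ u * ((σ δ₁ * b₁ - σ δ₂ * b₂) * a) + σ v * ((σ ε₂ * a₂ - σ ε₁ * a₁) * b)
      ≈⟨ solve 12 (λ u v d₁ d₂ e₁ e₂ a b a₁ a₂ b₁ b₂ →
           u :* ((d₁ :* b₁ :- d₂ :* b₂) :* a) :+ v :* ((e₂ :* a₂ :- e₁ :* a₁) :* b) :=
           (u :* d₁) :* (a :* b₁) :+ ((u :* (:- d₂)) :* (a :* b₂)
             :+ ((v :* e₂) :* (a₂ :* b) :+ (v :* (:- e₁)) :* (a₁ :* b))))
           ≈-refl (σ u) (σ v) (σ δ₁) (σ δ₂) (σ ε₁) (σ ε₂) a b a₁ a₂ b₁ b₂ ⟩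
    (σ u * σ δ₁) * (a * b₁) + ((σ u * - σ δ₂) * (a * b₂)
      + ((σ v * σ ε₂) * (a₂ * b) + (σ v * - σ ε₁) * (a₁ * b)))
      ≈⟨ +-cong (*-congʳ (σ-* u δ₁)) (+-cong (*-congʳ (σ-*-opposite u δ₂))
           (+-cong (*-congʳ (σ-* v ε₂)) (*-congʳ (σ-*-opposite v ε₁)))) ⟨
    σ (u *ˢ δ₁) * (a * b₁) + (σ (u *ˢ opposite δ₂) * (a * b₂)
      + (σ (v *ˢ ε₂) * (a₂ * b) + σ (v *ˢ opposite ε₁) * (a₁ * b)))
      ∎

enumerate : ∀ {n} (p : Subset n) → Fin ∣ p ∣ → Fin n
enumerate (true  ∷ p) Fin.zero    = Fin.zero
enumerate (true  ∷ p) (Fin.suc i) = Fin.suc (enumerate p i)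
enumerate (false ∷ p) i           = Fin.suc (enumerate p i)

enumerate-∈ : ∀ {n} (p : Subset n) (i : Fin ∣ p ∣) → enumerate p i ∈ p
enumerate-∈ (true  ∷ p) Fin.zero    = here
enumerate-∈ (true  ∷ p) (Fin.suc i) = there (enumerate-∈ p i)
enumerate-∈ (false ∷ p) i           = there (enumerate-∈ p i)

enumerate-injective : ∀ {n} (p : Subset n) → Injective _≡_ _≡_ (enumerate p)
enumerate-injective (true ∷ p) {Fin.zero}  {Fin.zero}  _  = refl
enumerate-injective (true ∷ p) {Fin.zero}  {Fin.suc j} ()
enumerate-injective (true ∷ p) {Fin.suc i} {Fin.zero}  ()
enumerate-injective (true ∷ p) {Fin.suc i} {Fin.suc j} e =
  cong Fin.suc (enumerate-injective p (suc-injective e))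
enumerate-injective (false ∷ p) e =
  enumerate-injective p (suc-injective e)

collision : ∀ {m n k} → k <ℕ m +ℕ n → (f : Fin m → Fin k) (g : Fin n → Fin k) →
            Injective _≡_ _≡_ f → Injective _≡_ _≡_ g →
            Σ (Fin m) λ i → Σ (Fin n) λ j → f i ≡ g j
collision {m} {n} k<m+n f g f-injective g-injective
  with any? (λ i → any? λ j → f i Fin.≟ g j)
... | yes common = common
... | no disjoint = contradiction (injective⇒≤ joint-injective) (ℕP.<⇒≱ k<m+n)
  where
  copair-injective : ∀ u v → [ f , g ]′ u ≡ [ f , g ]′ v → u ≡ v
  copair-injective (inj₁ i) (inj₁ j) e = cong inj₁ (f-injective e)
  copair-injective (inj₁ i) (inj₂ j) e = ⊥-elim (disjoint (i , j , e))
  copair-injective (inj₂ i) (inj₁ j) e = ⊥-elim (disjoint (j , i , ≡-sym e))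
  copair-injective (inj₂ i) (inj₂ j) e = cong inj₂ (g-injective e)

  joint-injective : Injective _≡_ _≡_ ([ f , g ]′ ∘ Fin.splitAt m)
  joint-injective {i} {j} e = ≡-trans (≡-sym (join-splitAt m n i))
    (≡-trans (cong (Fin.join m n) (copair-injective (Fin.splitAt m i) (Fin.splitAt m j) e)) (join-splitAt m n j))

<-half-sum : ∀ {q} x y → q <ℕ 2 *ℕ x → q <ℕ 2 *ℕ y → q <ℕ x +ℕ y
<-half-sum {q} x y q<2x q<2y = ℕP.*-cancelˡ-< 2 q (x +ℕ y) (begin-strict
  2 *ℕ q              ≡⟨ cong (q +ℕ_) (ℕP.+-identityʳ q) ⟩
  q +ℕ q              <⟨ ℕP.+-mono-< q<2x q<2y ⟩
  2 *ℕ x +ℕ 2 *ℕ y    ≡⟨ ℕP.*-distribˡ-+ 2 x y ⟨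
  2 *ℕ (x +ℕ y)       ∎)
  where open ℕP.≤-Reasoning

-- Sign bookkeeping

-- number of products a·b (a ∈ A, b ∈ B) needed for ±a·b when −A ⊆ A + A
cost : Sign → ℕ
cost Sign.+ = 1
cost Sign.- = 2

-- cost of the four signed products of u(δ₁b₁ − δ₂b₂)a + v(ε₂a₂ − ε₁a₁)b
fourCost : (ε₁ δ₁ ε₂ δ₂ u v : Sign) → ℕ
fourCost ε₁ δ₁ ε₂ δ₂ u v = cost (u *ˢ δ₁) +ℕ (cost (u *ˢ opposite δ₂)
  +ℕ (cost (v *ˢ ε₂) +ℕ cost (v *ˢ opposite ε₁)))

-- cost of x = ε(ta + sb) + η(ta') + (−η)(sb') for the signs (ε , η)
totalCost : (ε₁ δ₁ ε₂ δ₂ : Sign) → Sign × Sign → ℕ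
totalCost ε₁ δ₁ ε₂ δ₂ (ε , η) =
  fourCost ε₁ δ₁ ε₂ δ₂ ε ε +ℕ fourCost ε₁ δ₁ ε₂ δ₂ η (opposite η)

balancing : (ε₁ ε₂ δ₁ : Sign) → Sign × Sign
balancing Sign.+ Sign.- _ = Sign.- , Sign.+
balancing Sign.- Sign.+ _ = Sign.+ , Sign.-
balancing Sign.+ Sign.+ δ = δ , δ
balancing Sign.- Sign.- δ = δ , δ

balancing-cost : ∀ ε₁ δ₁ ε₂ δ₂ → (ε₁ , δ₁) ≢ (ε₂ , δ₂) →
                 totalCost ε₁ δ₁ ε₂ δ₂ (balancing ε₁ ε₂ δ₁) ≡ 10
balancing-cost Sign.+ Sign.+ Sign.+ Sign.+ distinct = ⊥-elim (distinct refl)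
balancing-cost Sign.+ Sign.+ Sign.+ Sign.- _ = refl
balancing-cost Sign.+ Sign.+ Sign.- Sign.+ _ = refl
balancing-cost Sign.+ Sign.+ Sign.- Sign.- _ = refl
balancing-cost Sign.+ Sign.- Sign.+ Sign.+ _ = refl
balancing-cost Sign.+ Sign.- Sign.+ Sign.- distinct = ⊥-elim (distinct refl)
balancing-cost Sign.+ Sign.- Sign.- Sign.+ _ = refl
balancing-cost Sign.+ Sign.- Sign.- Sign.- _ = refl
balancing-cost Sign.- Sign.+ Sign.+ Sign.+ _ = refl
balancing-cost Sign.- Sign.+ Sign.+ Sign.- _ = refl
balancing-cost Sign.- Sign.+ Sign.- Sign.+ distinct = ⊥-elim (distinct refl)
balancing-cost Sign.- Sign.+ Sign.- Sign.- _ = refl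
balancing-cost Sign.- Sign.- Sign.+ Sign.+ _ = refl
balancing-cost Sign.- Sign.- Sign.+ Sign.- _ = refl
balancing-cost Sign.- Sign.- Sign.- Sign.+ _ = refl
balancing-cost Sign.- Sign.- Sign.- Sign.- distinct = ⊥-elim (distinct refl)

module InField (F : FiniteField) where
  open FiniteField F renaming (refl to ≈-refl)
  open FF F
  open Signs commRing
  open Identities commRing
  open IntegerCoefficients commRing using (solve; _:=_; _:-_; _:+_)
  open import Algebra.Properties.Ring ring using (-1*x≈-x; -‿distribˡ-*)
  open import Algebra.Properties.Group +-group using (∙-cancelˡ; x∙y⁻¹≈ε⇒x≈y)
  open import Algebra.Properties.CommutativeSemigroup *-commutativeSemigroup
    using (x∙yz≈y∙xz)
  open import Relation.Binary.Reasoning.Setoid setoid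

  sgn≈σ* : ∀ s x → sgn s x ≈ σ s * x
  sgn≈σ* Sign.+ x = sym (*-identityˡ x)
  sgn≈σ* Sign.- x = sym (-1*x≈-x x)

  index : Carrier → Fin q
  index x = proj₁ (elem-sur x)

  elem-index : ∀ x → elem (index x) ≈ x
  elem-index x = proj₂ (elem-sur x)

  index-injective : ∀ {x y} → index x ≡ index y → x ≈ y
  index-injective {x} {y} e =
    trans (sym (elem-index x)) (trans (reflexive (cong elem e)) (elem-index y))

  image2⁻ : ∀ f A B {k} → k ∈ image2 f A B →
            Σ (Fin q) λ i → Σ (Fin q) λ j → i ∈ A × j ∈ B × (f (elem i) (elem j) ≈ elem k)
  image2⁻ f A B {k} k∈ = witness (invert (subst (Reflects _) is-true (proof decision)))
    where
    Witness : Set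
    Witness = Σ (Fin q) λ i → Σ (Fin q) λ j → T (lookup A i ∧ lookup B j) × (f (elem i) (elem j) ≈ elem k)

    decision : Dec Witness
    decision = any? λ i → any? λ j → T? (lookup A i ∧ lookup B j) ×-dec (f (elem i) (elem j) ≟ elem k)

    is-true : does decision ≡ true
    is-true = ≡-trans (≡-sym (lookup∘tabulate _ k)) ([]=⇒lookup k∈)

    member : ∀ C {i} → T (lookup C i) → i ∈ C
    member C {i} = lookup⇒[]= i C ∘ Equivalence.to T-≡

    witness : Witness →
              Σ (Fin q) λ i → Σ (Fin q) λ j → i ∈ A × j ∈ B × (f (elem i) (elem j) ≈ elem k)
    witness (i , j , i,j∈ , fij≈k) =
      i , j , member A (proj₁ (Equivalence.to T-∧ i,j∈)) ,
              member B (proj₂ (Equivalence.to T-∧ i,j∈)) , fij≈k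

  cover : (X Y : Subset q) → q <ℕ ∣ X ∣ +ℕ ∣ Y ∣ → (ε η : Sign) (z : Carrier) →
          Σ (Fin q) λ k → Σ (Fin q) λ l → k ∈ X × l ∈ Y × (z ≈ σ ε * elem k + σ η * elem l)
  cover X Y large ε η z = conclude (collision large (enumerate X) (index ∘ partner ∘ elem ∘ enumerate Y)
                                      (enumerate-injective X) partners-injective)
    where
    partner : Carrier → Carrier
    partner l = σ ε * (z - σ η * l)

    recover : ∀ l → z ≈ σ ε * partner l + σ η * l
    recover l = begin
      z                              ≈⟨ solve 2 (λ z w → z := (z :- w) :+ w) ≈-refl z (σ η * l) ⟩
      (z - σ η * l) + σ η * l        ≈⟨ +-congʳ (σ-cancel ε _) ⟨
      σ ε * partner l + σ η * l      ∎

    partner-injective : ∀ {u v} → partner u ≈ partner v → u ≈ v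
    partner-injective {u} {v} e = begin
      u                   ≈⟨ σ-cancel η u ⟨
      σ η * (σ η * u)     ≈⟨ *-congˡ (∙-cancelˡ (σ ε * partner u) _ _
                               (trans (sym (recover u)) (trans (recover v) (+-congʳ (*-congˡ (sym e)))))) ⟩
      σ η * (σ η * v)     ≈⟨ σ-cancel η v ⟩
      v                   ∎

    partners-injective : Injective _≡_ _≡_ (index ∘ partner ∘ elem ∘ enumerate Y)
    partners-injective e =
      enumerate-injective Y (elem-inj _ _ (partner-injective (index-injective e)))

    conclude : (Σ (Fin ∣ X ∣) λ i → Σ (Fin ∣ Y ∣) λ j →
                  enumerate X i ≡ index (partner (elem (enumerate Y j)))) →
               Σ (Fin q) λ k → Σ (Fin q) λ l → k ∈ X × l ∈ Y × (z ≈ σ ε * elem k + σ η * elem l)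
    conclude (i , j , e) = enumerate X i , enumerate Y j , enumerate-∈ X i , enumerate-∈ Y j , (begin
      z                                                        ≈⟨ recover (elem (enumerate Y j)) ⟩
      σ ε * partner (elem (enumerate Y j)) + σ η * elem (enumerate Y j)
        ≈⟨ +-congʳ (*-congˡ (trans (sym (elem-index _)) (reflexive (cong elem (≡-sym e))))) ⟩
      σ ε * elem (enumerate X i) + σ η * elem (enumerate Y j)  ∎)

  sumset-cover : ∀ A B ξ → q <ℕ 2 *ℕ ∣ image2 (λ a b → a + ξ * b) A B ∣ →
    q <ℕ 2 *ℕ ∣ image2 (λ a b → a - ξ * b) A B ∣ →
    (ε η : Sign) (z : Carrier) →
    Σ (Fin q) λ a → Σ (Fin q) λ b → Σ (Fin q) λ a' → Σ (Fin q) λ b' →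
      a ∈ A × b ∈ B × a' ∈ A × b' ∈ B ×
      (z ≈ σ ε * (elem a + ξ * elem b) + σ η * (elem a' - ξ * elem b'))
  sumset-cover A B ξ |A+ξB|>q/2 |A−ξB|>q/2 ε η z =
    let (k , l , k∈ , l∈ , z≈εk+ηl) = cover (image2 plus A B) (image2 minus A B)
          (<-half-sum ∣ image2 plus A B ∣ ∣ image2 minus A B ∣ |A+ξB|>q/2 |A−ξB|>q/2) ε η z
        (a , b , a∈A , b∈B , a+ξb≈k) = image2⁻ plus A B k∈
        (a' , b' , a'∈A , b'∈B , a'-ξb'≈l) = image2⁻ minus A B l∈
    in a , b , a' , b' , a∈A , b∈B , a'∈A , b'∈B ,
       trans z≈εk+ηl (sym (+-cong (*-congˡ a+ξb≈k) (*-congˡ a'-ξb'≈l)))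
    where
    plus minus : Carrier → Carrier → Carrier
    plus  a b = a + ξ * b
    minus a b = a - ξ * b

  ProductSum : Subset q → Subset q → ℕ → Carrier → Set
  ProductSum A B n y = Σ (Fin n → Fin q) λ a → Σ (Fin n → Fin q) λ b →
    All (_∈ A) a × All (_∈ B) b × (y ≈ Σ[ n ] (λ t → elem (a t) * elem (b t)))

  Σ-cong : ∀ n {f g : Fin n → Carrier} → (∀ i → f i ≈ g i) → Σ[ n ] f ≈ Σ[ n ] g
  Σ-cong 0       f≈g = ≈-refl
  Σ-cong (suc n) f≈g = +-cong (f≈g Fin.zero) (Σ-cong n (f≈g ∘ Fin.suc))

  Σ-split : ∀ m {n} (h : Fin (m +ℕ n) → Carrier) →
            Σ[ m +ℕ n ] h ≈ Σ[ m ] (h ∘ (Fin._↑ˡ n)) + Σ[ n ] (h ∘ (m Fin.↑ʳ_))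
  Σ-split 0       h = sym (+-identityˡ _)
  Σ-split (suc m) h =
    trans (+-congˡ (Σ-split m (h ∘ Fin.suc))) (sym (+-assoc _ _ _))

  infixr 5 _+ᴾ_
  _+ᴾ_ : ∀ {A B m n y z} → ProductSum A B m y → ProductSum A B n z → ProductSum A B (m +ℕ n) (y + z)
  _+ᴾ_ {A} {B} {m} {n} {y} {z} (a₁ , b₁ , a₁∈A , b₁∈B , y≈) (a₂ , b₂ , a₂∈A , b₂∈B , z≈) =
    a₁ ++ a₂ , b₁ ++ b₂ , ++⁺ (_∈ A) a₁∈A a₂∈A , ++⁺ (_∈ B) b₁∈B b₂∈B , (begin
      y + z
        ≈⟨ +-cong y≈ z≈ ⟩
      Σ[ m ] (λ t → elem (a₁ t) * elem (b₁ t)) + Σ[ n ] (λ t → elem (a₂ t) * elem (b₂ t))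
        ≈⟨ +-cong (Σ-cong m λ i → reflexive (cong₂ product (lookup-++ˡ a₁ a₂ i) (lookup-++ˡ b₁ b₂ i)))
                  (Σ-cong n λ i → reflexive (cong₂ product (lookup-++ʳ a₁ a₂ i) (lookup-++ʳ b₁ b₂ i))) ⟨
      Σ[ m ] (λ t → product ((a₁ ++ a₂) (t Fin.↑ˡ n)) ((b₁ ++ b₂) (t Fin.↑ˡ n)))
        + Σ[ n ] (λ t → product ((a₁ ++ a₂) (m Fin.↑ʳ t)) ((b₁ ++ b₂) (m Fin.↑ʳ t)))
        ≈⟨ Σ-split m _ ⟨
      Σ[ m +ℕ n ] (λ t → elem ((a₁ ++ a₂) t) * elem ((b₁ ++ b₂) t))
        ∎)
    where
    product : Fin q → Fin q → Carrier
    product i j = elem i * elem j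

  productSum-resp : ∀ {A B n y z} → z ≈ y → ProductSum A B n y → ProductSum A B n z
  productSum-resp z≈y (a , b , a∈A , b∈B , y≈) = a , b , a∈A , b∈B , trans z≈y y≈

  MinusInSumset : Subset q → Set
  MinusInSumset A = (i : Fin q) → i ∈ A → Σ (Fin q) λ j → Σ (Fin q) λ k →
    j ∈ A × k ∈ A × (- elem i ≈ elem j + elem k)

  signed-product : ∀ {A B} → MinusInSumset A → (s : Sign) {a b : Fin q} → a ∈ A → b ∈ B →
                   ProductSum A B (cost s) (σ s * (elem a * elem b))
  signed-product _ Sign.+ {a} {b} a∈A b∈B =
    (λ _ → a) , (λ _ → b) , (λ _ → a∈A) , (λ _ → b∈B) ,
    trans (*-identityˡ _) (sym (+-identityʳ _))
  signed-product −A⊆A+A Sign.- {a} {b} a∈A b∈B =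
    let (j , k , j∈A , k∈A , −a≈j+k) = −A⊆A+A a a∈A
    in (λ { Fin.zero → j ; (Fin.suc _) → k }) , (λ _ → b) ,
       (λ { Fin.zero → j∈A ; (Fin.suc _) → k∈A }) , (λ _ → b∈B) , (begin
         - 1# * (elem a * elem b)               ≈⟨ -1*x≈-x _ ⟩
         - (elem a * elem b)                    ≈⟨ -‿distribˡ-* _ _ ⟩
         - elem a * elem b                      ≈⟨ *-congʳ −a≈j+k ⟩
         (elem j + elem k) * elem b             ≈⟨ distribʳ _ _ _ ⟩
         elem j * elem b + elem k * elem b      ≈⟨ +-congˡ (+-identityʳ _) ⟨
         elem j * elem b + (elem k * elem b + 0#) ∎)

  module Collision
    (A B : Subset q) (ξ : Carrier) (ε₁ δ₁ ε₂ δ₂ : Sign) (a₁ b₁ a₂ b₂ : Fin q)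
    (distinct : (ε₁ , δ₁) ≢ (ε₂ , δ₂))
    (a₁∈A : a₁ ∈ A) (b₁∈B : b₁ ∈ B) (a₂∈A : a₂ ∈ A) (b₂∈B : b₂ ∈ B)
    (collides : sgn ε₁ (elem a₁) + sgn δ₁ (ξ * elem b₁) ≈ sgn ε₂ (elem a₂) + sgn δ₂ (ξ * elem b₂))
    (nontrivial : ¬ (sgn ε₁ (elem a₁) ≈ sgn ε₂ (elem a₂)))
    where

    -- ξ = s / t
    t s : Carrier
    t = σ δ₁ * elem b₁ - σ δ₂ * elem b₂
    s = σ ε₂ * elem a₂ - σ ε₁ * elem a₁

    ξt≈s : ξ * t ≈ s
    ξt≈s = slope ξ _ _ (σ δ₁) (σ δ₂) _ _ (begin
      σ ε₁ * elem a₁ + σ δ₁ * (ξ * elem b₁)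
        ≈⟨ +-cong (sgn≈σ* ε₁ _) (sgn≈σ* δ₁ _) ⟨
      sgn ε₁ (elem a₁) + sgn δ₁ (ξ * elem b₁)
        ≈⟨ collides ⟩
      sgn ε₂ (elem a₂) + sgn δ₂ (ξ * elem b₂)
        ≈⟨ +-cong (sgn≈σ* ε₂ _) (sgn≈σ* δ₂ _) ⟩
      σ ε₂ * elem a₂ + σ δ₂ * (ξ * elem b₂)
        ∎)

    -- t = 0 would force ε₁a₁ = ε₂a₂, i.e. a trivial collision
    t≉0 : ¬ (t ≈ 0#)
    t≉0 t≈0 = nontrivial (begin
      sgn ε₁ (elem a₁)    ≈⟨ sgn≈σ* ε₁ _ ⟩
      σ ε₁ * elem a₁      ≈⟨ x∙y⁻¹≈ε⇒x≈y _ _ s≈0 ⟨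
      σ ε₂ * elem a₂      ≈⟨ sgn≈σ* ε₂ _ ⟨
      sgn ε₂ (elem a₂)    ∎)
      where
      s≈0 : s ≈ 0#
      s≈0 = trans (sym ξt≈s) (trans (*-congˡ t≈0) (zeroʳ ξ))

    t⁻¹ : Carrier
    t⁻¹ = proj₁ (inverse t t≉0)

    unscale : ∀ {x w} → x * t⁻¹ ≈ w → x ≈ t * w
    unscale {x} {w} x/t≈w = begin
      x                ≈⟨ *-identityʳ x ⟨
      x * 1#           ≈⟨ *-congˡ (proj₂ (inverse t t≉0)) ⟨
      x * (t * t⁻¹)    ≈⟨ x∙yz≈y∙xz x t t⁻¹ ⟩
      t * (x * t⁻¹)    ≈⟨ *-congˡ x/t≈w ⟩
      t * w            ∎

    four-products-sum : MinusInSumset A → (u v : Sign) {a b : Fin q} → a ∈ A → b ∈ B →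
      ProductSum A B (fourCost ε₁ δ₁ ε₂ δ₂ u v) (σ u * (t * elem a) + σ v * (s * elem b))
    four-products-sum −A⊆A+A u v a∈A b∈B =
      productSum-resp (four-products u v δ₁ δ₂ ε₁ ε₂ _ _ _ _ _ _)
        (signed-product −A⊆A+A (u *ˢ δ₁) a∈A b₁∈B
          +ᴾ signed-product −A⊆A+A (u *ˢ opposite δ₂) a∈A b₂∈B
          +ᴾ signed-product −A⊆A+A (v *ˢ ε₂) a₂∈A b∈B
          +ᴾ signed-product −A⊆A+A (v *ˢ opposite ε₁) a₁∈A b∈B)

    -- every x ∈ F_q lies in 10AB: write x t⁻¹ = ε(a + ξb) + η(a' − ξb') for the
    -- balancing signs (ε , η), multiply by t, and count the products
    in-10AB : MinusInSumset A →
      q <ℕ 2 *ℕ ∣ image2 (λ a b → a + ξ * b) A B ∣ → q <ℕ 2 *ℕ ∣ image2 (λ a b → a - ξ * b) A B ∣ →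
      (x : Carrier) → ProductSum A B 10 x
    in-10AB −A⊆A+A |A+ξB|>q/2 |A−ξB|>q/2 x =
      let (ε , η) = balancing ε₁ ε₂ δ₁
          (a , b , a' , b' , a∈A , b∈B , a'∈A , b'∈B , x/t≈) =
            sumset-cover A B ξ |A+ξB|>q/2 |A−ξB|>q/2 ε η (x * t⁻¹)
      in subst (λ n → ProductSum A B n x) (balancing-cost ε₁ δ₁ ε₂ δ₂ distinct)
           (productSum-resp (trans (unscale x/t≈) (expand ξ t s ε η _ _ _ _ ξt≈s))
             (four-products-sum −A⊆A+A ε ε a∈A b∈B
               +ᴾ four-products-sum −A⊆A+A η (opposite η) a'∈A b'∈B))

lemma5 : (F : FiniteField) → let open FiniteField F in let open FF F in
    (A B : Subset q) (ξ : Carrier) →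
    ¬ (ξ ≈ 0#) →
    q <ℕ ∣ A ∣ *ℕ ∣ B ∣ →
    ((i : Fin q) → i ∈ A → Σ (Fin q) λ j → Σ (Fin q) λ k →
       j ∈ A × k ∈ A × (- elem i ≈ elem j + elem k)) →
    ((i : Fin q) → i ∈ B → Σ (Fin q) λ j → Σ (Fin q) λ k →
       j ∈ B × k ∈ B × (- elem i ≈ elem j + elem k)) →
    q *ℕ solutions ξ A B <ℕ 2 *ℕ (∣ A ∣ *ℕ ∣ A ∣ *ℕ (∣ B ∣ *ℕ ∣ B ∣)) →
    q <ℕ 2 *ℕ ∣ image2 (λ a b → a + ξ * b) A B ∣ →
    q <ℕ 2 *ℕ ∣ image2 (λ a b → a - ξ * b) A B ∣ →
    (Σ Sign λ ε₁ → Σ Sign λ δ₁ → Σ Sign λ ε₂ → Σ Sign λ δ₂ →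
     Σ (Fin q) λ a₁ → Σ (Fin q) λ b₁ → Σ (Fin q) λ a₂ → Σ (Fin q) λ b₂ →
       (ε₁ , δ₁) ≢ (ε₂ , δ₂) ×
       a₁ ∈ A × b₁ ∈ B × a₂ ∈ A × b₂ ∈ B ×
       (sgn ε₁ (elem a₁) + sgn δ₁ (ξ * elem b₁)
          ≈ sgn ε₂ (elem a₂) + sgn δ₂ (ξ * elem b₂)) ×
       ¬ (sgn ε₁ (elem a₁) ≈ sgn ε₂ (elem a₂))) →
    (x : Carrier) →
      Σ (Fin 10 → Fin q) λ a → Σ (Fin 10 → Fin q) λ b →
        ((t : Fin 10) → a t ∈ A) × ((t : Fin 10) → b t ∈ B) ×
        (x ≈ Σ[ 10 ] (λ t → elem (a t) * elem (b t)))
lemma5 F A B ξ _ _ −A⊆A+A _ _ |A+ξB|>q/2 |A−ξB|>q/2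
       (ε₁ , δ₁ , ε₂ , δ₂ , a₁ , b₁ , a₂ , b₂ , distinct , a₁∈A , b₁∈B , a₂∈A , b₂∈B ,
        collides , nontrivial) =
  Collision.in-10AB A B ξ ε₁ δ₁ ε₂ δ₂ a₁ b₁ a₂ b₂ distinct a₁∈A b₁∈B a₂∈A b₂∈B
    collides nontrivial −A⊆A+A |A+ξB|>q/2 |A−ξB|>q/2
  where open InField F
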